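{- For a string $S[1\mathinner{.\,.} n]$ with measure $\delta=\delta(S)$ and any block tree of $S$ (with any parameters $\tau,s$), the number of marked blocks of length $\tau^k$ in the block tree is $O(\delta)$, for every level $k$.
   Context: $d_k(S)$ is the number of distinct length-$k$ substrings of $S$ and $\delta(S)=\max\{d_k(S)/k : k\in[1\mathinner{.\,.} n]\}$. Block tree with integer parameters $\tau\ge2$ and $s\ge1$ (assume $n=s\cdot\tau^t$): the root level divides $S$ into $s$ consecutive blocks of equal length; at the level with block length $\tau^k$, $S$ is covered by the aligned blocks $S[\tau^k(i-1)+1\mathinner{.\,.}\tau^k i]$, of which only some are present. Among the present blocks, whenever two blocks $B',B''$ adjacent in $S$ form at their position the leftmost occurrence in $S$ of $B'\cdot B''$, both are marked; other blocks are unmarked and are replaced by a pointer to the pair of adjacent blocks containing their leftmost occurrence. Marked blocks are split into $\tau$ equal-length children forming the next level; recursion stops when block length falls below $\log_\sigma n$. -}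

module Defs where

open import Data.Nat using (ℕ; zero; suc; _+_; _*_; _∸_; _^_; _<ᵇ_; _≤ᵇ_; NonZero)
open import Data.Nat.DivMod using (_/_)
open import Data.Bool using (Bool; true; false; _∧_; _∨_; not; if_then_else_)
open import Data.List using (List; []; take; drop; map; upTo; length; deduplicate; foldr)
open import Data.Bool.ListAction using (any)
open import Data.Nat.ListAction using (sum)
open import Data.List.Properties using (≡-dec)
open import Relation.Nullary.Decidable using (⌊_⌋)
open import Data.Integer using (+_)
open import Data.Rational as ℚ using (ℚ; _⊔_; 0ℚ)
import Data.Nat as N

-- Strings over an alphabet of natural numbers; positions are 0-based.
Str : Set
Str = List ℕ

_≟s_ = ≡-dec N._≟_

substr : Str → ℕ → ℕ → Str
substr S p ℓ = take ℓ (drop p S)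

substrings : Str → ℕ → List Str
substrings S k =
  if k ≤ᵇ length S then map (λ p → substr S p k) (upTo (suc (length S ∸ k))) else []

d : Str → ℕ → ℕ
d S k = length (deduplicate _≟s_ (substrings S k))

δ : Str → ℚ
δ S = foldr _⊔_ 0ℚ (map (λ k → ℚ._/_ (+ d S (suc k)) (suc k)) (upTo (length S)))

-- Levels are indexed by depth e ∈ [0..t]; the level at depth e has block length τ^(t-e)
-- and candidate (aligned) blocks with 0-based indices i < s·τ^e, block i = S[i·τ^(t-e) .. (i+1)·τ^(t-e) - 1].
module BlockTree (S : Str) (τ s t : ℕ) .{{_ : NonZero τ}} where

  blen : ℕ → ℕ
  blen e = τ ^ (t ∸ e)

  nblocks : ℕ → ℕ
  nblocks e = s * τ ^ e

  leftmostPair : ℕ → ℕ → Bool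
  leftmostPair e i =
    not (any (λ p → ⌊ substr S p (2 * blen e) ≟s substr S (i * blen e) (2 * blen e) ⌋)
             (upTo (i * blen e)))

  mutual
    present : ℕ → ℕ → Bool
    present zero i = i <ᵇ s
    present (suc e) i = marked e (i / τ)

    marked : ℕ → ℕ → Bool
    marked e i = present e i ∧
      (((0 <ᵇ i) ∧ present e (i ∸ 1) ∧ leftmostPair e (i ∸ 1))
       ∨ (present e (suc i) ∧ leftmostPair e i))

  markedCount : ℕ → ℕ
  markedCount e = sum (map (λ i → if marked e i then 1 else 0) (upTo (nblocks e)))

-- Fix a level with block length ℓ and N blocks, n = N·ℓ.  A block is marked only if it
-- is one half of a "pair start": two adjacent present blocks i, i+1 whose concatenation
-- is the leftmost occurrence of that length-2ℓ string.  So #marked ≤ 2·#pairs, and all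
-- but at most two pair starts are interior (1 ≤ i ≤ N-3), hence #pairs ≤ 2 + #interior.
--
-- The amplification step: call a position b "fresh" for length m if the length-m
-- substring starting at b does not occur earlier in S.  Fresh positions carry pairwise
-- distinct substrings, so there are at most d_m(S) of them.  If the pair starting at
-- block i is a leftmost occurrence, every length-3ℓ window starting in block i-1
-- contains it and is therefore fresh; so each interior pair start yields ℓ fresh
-- positions for length 3ℓ, giving #interior · ℓ ≤ d_{3ℓ}(S).
--
-- Altogether #marked · 3ℓ ≤ 18 · d_{3ℓ}(S) (or #marked ≤ 4 ≤ 18 · d_1(S) when there is
-- no interior pair), and since d_m(S)/m ≤ δ(S) this gives #marked ≤ 18 · δ(S).
module Submission where

open import Defs
open import Data.Nat as N
  using (ℕ; zero; suc; _+_; _*_; _∸_; _^_; _≤_; _<_; z≤n; s≤s; NonZero)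
import Data.Nat.Properties as NP
open import Data.Nat.DivMod using (_/_; _%_; m≡m%n+[m/n]*n; m%n<n)
open import Data.Nat.Solver using (module +-*-Solver)
open import Data.Bool using (Bool; true; false; _∧_; _∨_; not; if_then_else_; T)
open import Data.Unit using (tt)
open import Data.Empty using (⊥-elim)
open import Data.Product using (∃-syntax; _×_; _,_)
open import Function using (_∘_; id)
open import Data.List
  using (List; []; _∷_; take; drop; map; filter; upTo; applyUpTo; length; deduplicate; foldr)
import Data.List.Properties as LP
open import Data.Bool.ListAction using (any)
open import Data.Nat.ListAction using (sum)
open import Data.List.Membership.Propositional using (_∈_)
open import Data.List.Membership.Propositional.Properties
  using (∈-map⁺; ∈-upTo⁺; ∈-deduplicate⁺)
open import Data.List.Relation.Unary.Any using (here; there)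
import Data.List.Relation.Unary.Any.Properties as AnyP
open import Data.List.Relation.Unary.All as All using (All; []; _∷_)
import Data.List.Relation.Unary.All.Properties as AllP
open import Data.List.Relation.Unary.AllPairs using (AllPairs; []; _∷_)
import Data.List.Relation.Unary.AllPairs.Properties as AllPairsP
open import Relation.Binary.PropositionalEquality
open import Relation.Nullary using (Dec; yes; no; ¬_)
open import Relation.Nullary.Decidable using (⌊_⌋; T?; toWitness; fromWitness)
open import Data.Integer as ℤ using (+_)
import Data.Integer.Properties as ℤP
open import Data.Rational as ℚ using (ℚ; _⊔_; 0ℚ)
import Data.Rational.Properties as ℚP
open import Data.Rational.Unnormalised as ℚᵘ using (mkℚᵘ)
import Data.Rational.Unnormalised.Properties as ℚᵘP

ind : Bool → ℕ
ind b = if b then 1 else 0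

ind≤1 : ∀ b → ind b ≤ 1
ind≤1 true = s≤s z≤n
ind≤1 false = z≤n

∧-left : ∀ {a b} → T (a ∧ b) → T a
∧-left {true} _ = tt

∧-right : ∀ {a b} → T (a ∧ b) → T b
∧-right {true} t = t

not-T : ∀ {a} → T (not a) → ¬ T a
not-T {false} _ ()

T-not : ∀ {a} → ¬ T a → T (not a)
T-not {true} ¬a = ¬a tt
T-not {false} _ = tt

count : (ℕ → Bool) → ℕ → ℕ
count f zero = 0
count f (suc n) = ind (f 0) + count (f ∘ suc) n

count≤ : ∀ f n → count f n ≤ n
count≤ f zero = z≤n
count≤ f (suc n) = NP.+-mono-≤ (ind≤1 (f 0)) (count≤ (f ∘ suc) n)

count-mono : ∀ f {m n} → m ≤ n → count f m ≤ count f n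
count-mono f z≤n = z≤n
count-mono f (s≤s m≤n) = NP.+-monoʳ-≤ (ind (f 0)) (count-mono (f ∘ suc) m≤n)

count-+ : ∀ f a b → count f (a + b) ≡ count f a + count (λ j → f (a + j)) b
count-+ f zero b = refl
count-+ f (suc a) b =
  trans (cong (λ x → ind (f 0) + x) (count-+ (f ∘ suc) a b)) (sym (NP.+-assoc (ind (f 0)) _ _))

count-last : ∀ f n → count f (suc n) ≡ count f n + ind (f n)
count-last f zero = NP.+-comm (ind (f 0)) 0
count-last f (suc n) =
  trans (cong (λ x → ind (f 0) + x) (count-last (f ∘ suc) n)) (sym (NP.+-assoc (ind (f 0)) _ _))

count-full : ∀ f n → (∀ {i} → i < n → T (f i)) → count f n ≡ n
count-full f zero _ = refl
count-full f (suc n) all with f 0 | all (s≤s z≤n)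
... | true | _ = cong suc (count-full (f ∘ suc) n (all ∘ s≤s))

count-≤-+ : ∀ f g h n → (∀ i → ind (f i) ≤ ind (g i) + ind (h i)) →
            count f n ≤ count g n + count h n
count-≤-+ f g h zero _ = z≤n
count-≤-+ f g h (suc n) pointwise = begin
  ind (f 0) + count (f ∘ suc) n
    ≤⟨ NP.+-mono-≤ (pointwise 0) (count-≤-+ (f ∘ suc) (g ∘ suc) (h ∘ suc) n (pointwise ∘ suc)) ⟩
  (ind (g 0) + ind (h 0)) + (count (g ∘ suc) n + count (h ∘ suc) n)
    ≡⟨ interchange (ind (g 0)) (ind (h 0)) (count (g ∘ suc) n) (count (h ∘ suc) n) ⟩
  (ind (g 0) + count (g ∘ suc) n) + (ind (h 0) + count (h ∘ suc) n) ∎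
  where
  open NP.≤-Reasoning
  open +-*-Solver
  interchange : ∀ a b c e → (a + b) + (c + e) ≡ (a + c) + (b + e)
  interchange = solve 4 (λ a b c e → (a :+ b) :+ (c :+ e) := (a :+ c) :+ (b :+ e)) refl

shiftʳ : (ℕ → Bool) → ℕ → Bool
shiftʳ g zero = false
shiftʳ g (suc i) = g i

count-shiftʳ : ∀ g n → count (shiftʳ g) n ≤ count g n
count-shiftʳ g zero = z≤n
count-shiftʳ g (suc n) = count-mono g (NP.n≤1+n n)

count-blocks : ∀ f h ℓ K → (∀ {j r} → j < K → r < ℓ → T (h j) → T (f (j * ℓ + r))) →
               count h K * ℓ ≤ count f (K * ℓ)
count-blocks f h ℓ zero _ = z≤n
count-blocks f h ℓ (suc K) forces = begin
  (ind (h 0) + count (h ∘ suc) K) * ℓ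
    ≡⟨ NP.*-distribʳ-+ ℓ (ind (h 0)) (count (h ∘ suc) K) ⟩
  ind (h 0) * ℓ + count (h ∘ suc) K * ℓ
    ≤⟨ NP.+-mono-≤ (first-block (h 0) refl) rest ⟩
  count f ℓ + count (λ x → f (ℓ + x)) (K * ℓ)
    ≡⟨ count-+ f ℓ (K * ℓ) ⟨
  count f (ℓ + K * ℓ) ∎
  where
  open NP.≤-Reasoning
  first-block : ∀ b → h 0 ≡ b → ind b * ℓ ≤ count f ℓ
  first-block false _ = z≤n
  first-block true h0 = NP.≤-reflexive (trans (NP.+-identityʳ ℓ)
    (sym (count-full f ℓ (λ r<ℓ → forces (s≤s z≤n) r<ℓ (subst T (sym h0) tt)))))
  rest : count (h ∘ suc) K * ℓ ≤ count (λ x → f (ℓ + x)) (K * ℓ)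
  rest = count-blocks (λ x → f (ℓ + x)) (h ∘ suc) ℓ K λ {j} {r} j<K r<ℓ hj →
    subst (T ∘ f) (NP.+-assoc ℓ (j * ℓ) r) (forces (s≤s j<K) r<ℓ hj)

count-trim : ∀ f N → (∀ i → T (f i) → i + 2 ≤ N) →
             count f N ≤ 2 + count (f ∘ suc) (N ∸ 3)
count-trim f 0 _ = z≤n
count-trim f 1 _ = NP.≤-trans (count≤ f 1) (s≤s z≤n)
count-trim f 2 _ = count≤ f 2
count-trim f (suc (suc (suc K))) bound = begin
  ind (f 0) + count (f ∘ suc) (suc (suc K))
    ≡⟨ cong (λ x → ind (f 0) + x) (count-last (f ∘ suc) (suc K)) ⟩
  ind (f 0) + (count (f ∘ suc) (suc K) + ind (f (2 + K)))
    ≡⟨ cong (λ x → ind (f 0) + (count (f ∘ suc) (suc K) + x)) vanishes ⟩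
  ind (f 0) + (count (f ∘ suc) (suc K) + 0)
    ≡⟨ cong (λ x → ind (f 0) + (x + 0)) (count-last (f ∘ suc) K) ⟩
  ind (f 0) + ((count (f ∘ suc) K + ind (f (suc K))) + 0)
    ≤⟨ NP.+-mono-≤ (ind≤1 (f 0)) (NP.+-monoˡ-≤ 0 (NP.+-monoʳ-≤ _ (ind≤1 (f (suc K))))) ⟩
  1 + ((count (f ∘ suc) K + 1) + 0)
    ≡⟨ cong suc (trans (NP.+-identityʳ _) (NP.+-comm (count (f ∘ suc) K) 1)) ⟩
  2 + count (f ∘ suc) K ∎
  where
  open NP.≤-Reasoning
  vanishes : ind (f (2 + K)) ≡ 0
  vanishes with f (2 + K) in eq
  ... | false = refl
  ... | true = ⊥-elim (NP.n≮n (2 + K) (NP.≤-pred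
                 (subst (_≤ 3 + K) (NP.+-comm (2 + K) 2) (bound (2 + K) (subst T (sym eq) tt)))))

length-filter-applyUpTo : ∀ (f : ℕ → Bool) (g : ℕ → ℕ) n →
  length (filter (T? ∘ f) (applyUpTo g n)) ≡ count (f ∘ g) n
length-filter-applyUpTo f g zero = refl
length-filter-applyUpTo f g (suc n) with f (g 0)
... | true = cong suc (length-filter-applyUpTo f (g ∘ suc) n)
... | false = length-filter-applyUpTo f (g ∘ suc) n

module _ {A : Set} (_≟_ : (x y : A) → Dec (x ≡ y)) where

  delete : A → List A → List A
  delete x [] = []
  delete x (z ∷ zs) with x ≟ z
  ... | yes _ = zs
  ... | no _ = z ∷ delete x zs

  length-delete : ∀ {x} zs → x ∈ zs → suc (length (delete x zs)) ≡ length zs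
  length-delete {x} (z ∷ zs) x∈ with x ≟ z | x∈
  ... | yes _ | _ = refl
  ... | no x≢z | here x≡z = ⊥-elim (x≢z x≡z)
  ... | no _ | there x∈zs = cong suc (length-delete zs x∈zs)

  ∈-delete : ∀ {x y} zs → y ∈ zs → y ≢ x → y ∈ delete x zs
  ∈-delete {x} (z ∷ zs) y∈ y≢x with x ≟ z | y∈
  ... | yes x≡z | here y≡z = ⊥-elim (y≢x (trans y≡z (sym x≡z)))
  ... | yes _ | there y∈zs = y∈zs
  ... | no _ | here y≡z = here y≡z
  ... | no _ | there y∈zs = there (∈-delete zs y∈zs y≢x)

  distinct-length≤ : ∀ {xs ys : List A} → AllPairs _≢_ xs → All (_∈ ys) xs →
                     length xs ≤ length ys
  distinct-length≤ {[]} _ _ = z≤n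
  distinct-length≤ {x ∷ xs} {ys} (x≢xs ∷ distinct) (x∈ys ∷ xs⊆ys) =
    subst (suc (length xs) ≤_) (length-delete ys x∈ys)
      (s≤s (distinct-length≤ distinct (All.zipWith moved (x≢xs , xs⊆ys))))
    where
    moved : ∀ {y} → x ≢ y × y ∈ ys → y ∈ delete x ys
    moved (x≢y , y∈ys) = ∈-delete ys y∈ys (x≢y ∘ sym)

substr-substr : ∀ (S : Str) a o L M → o + L ≤ M →
                substr (substr S a M) o L ≡ substr S (a + o) L
substr-substr S a o L M o+L≤M = begin
  take L (drop o (take M X))         ≡⟨ LP.take-drop L o (take M X) ⟩
  drop o (take (o + L) (take M X))   ≡⟨ cong (drop o) (LP.take-take (o + L) M X) ⟩
  drop o (take ((o + L) N.⊓ M) X)    ≡⟨ cong (λ k → drop o (take k X)) (NP.m≤n⇒m⊓n≡m o+L≤M) ⟩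
  drop o (take (o + L) X)            ≡⟨ LP.take-drop L o X ⟨
  take L (drop o X)                  ≡⟨ cong (take L) (LP.drop-drop a o S) ⟩
  take L (drop (a + o) S)            ∎
  where
  open ≡-Reasoning
  X = drop a S

-- Position b is fresh for length m if S[b .. b+m) does not occur at an earlier position.
-- (leftmostPair e i of Defs is, by definition, fresh S (2·ℓ) (i·ℓ).)
fresh : Str → ℕ → ℕ → Bool
fresh S m b = not (any (λ p → ⌊ substr S p m ≟s substr S b m ⌋) (upTo b))

fresh⇒new : ∀ S m {a b} → T (fresh S m b) → a < b → substr S a m ≢ substr S b m
fresh⇒new S m b-fresh a<b same =
  not-T b-fresh (AnyP.any⁺ _ (AnyP.applyUpTo⁺ _ (fromWitness same) a<b))

new⇒fresh : ∀ S m b → (∀ {a} → a < b → substr S a m ≢ substr S b m) → T (fresh S m b)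
new⇒fresh S m b new = T-not λ occurs →
  let (a , a<b , same) = AnyP.applyUpTo⁻ _ (AnyP.any⁻ _ _ occurs) in new a<b (toWitness same)

-- A window S[b .. b+m) containing a fresh occurrence S[p .. p+m') is itself fresh:
-- an earlier copy of the window would contain an earlier copy of S[p .. p+m').
fresh-window : ∀ S m m' b p → b ≤ p → p + m' ≤ b + m →
               T (fresh S m' p) → T (fresh S m b)
fresh-window S m m' b p b≤p p+m'≤b+m p-fresh = new⇒fresh S m b λ {a} a<b same →
  fresh⇒new S m' p-fresh (earlier a<b) (begin
    substr S (a + o) m'                ≡⟨ substr-substr S a o m' m inside ⟨
    substr (substr S a m) o m'         ≡⟨ cong (λ w → substr w o m') same ⟩
    substr (substr S b m) o m'         ≡⟨ substr-substr S b o m' m inside ⟩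
    substr S (b + o) m'                ≡⟨ cong (λ x → substr S x m') (NP.m+[n∸m]≡n b≤p) ⟩
    substr S p m'                      ∎)
  where
  open ≡-Reasoning
  o = p ∸ b
  inside : o + m' ≤ m
  inside = NP.+-cancelˡ-≤ b _ _ (subst (_≤ b + m)
    (trans (cong (_+ m') (sym (NP.m+[n∸m]≡n b≤p))) (NP.+-assoc b o m')) p+m'≤b+m)
  earlier : ∀ {a} → a < b → a + o < p
  earlier {a} a<b = subst (a + o <_) (NP.m+[n∸m]≡n b≤p) (NP.+-monoˡ-< o a<b)

substr∈substrings : ∀ S m {b} → b < suc (length S) ∸ m → substr S b m ∈ substrings S m
substr∈substrings S m {b} b<range with m N.≤? length S
... | no m≰n = ⊥-elim (NP.n≮0 (subst (b <_) (NP.m≤n⇒m∸n≡0 (NP.≰⇒> m≰n)) b<range))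
... | yes m≤n = subst (substr S b m ∈_) (sym unfold)
      (∈-map⁺ (λ p → substr S p m) (∈-upTo⁺ (subst (b <_) (NP.+-∸-assoc 1 m≤n) b<range)))
  where
  unfold : substrings S m ≡ map (λ p → substr S p m) (upTo (suc (length S ∸ m)))
  unfold = cong (λ c → if c then map (λ p → substr S p m) (upTo (suc (length S ∸ m))) else [])
                (T-true (NP.≤⇒≤ᵇ m≤n))
    where
    T-true : ∀ {c} → T c → c ≡ true
    T-true {true} _ = refl

-- The key counting bound: the fresh positions (among the valid starting positions)
-- carry pairwise distinct substrings, so there are at most d_m(S) of them.
fresh≤d : ∀ S m → count (fresh S m) (suc (length S) ∸ m) ≤ d S m
fresh≤d S m = begin
  count (fresh S m) X              ≡⟨ length-filter-applyUpTo (fresh S m) id X ⟨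
  length P                         ≡⟨ LP.length-map window P ⟨
  length (map window P)            ≤⟨ distinct-length≤ _≟s_ distinct contained ⟩
  d S m                            ∎
  where
  open NP.≤-Reasoning
  X = suc (length S) ∸ m
  window = λ b → substr S b m
  P = filter (T? ∘ fresh S m) (upTo X)
  distinct-windows : ∀ {Q} → AllPairs _<_ Q → All (T ∘ fresh S m) Q → AllPairs _≢_ (map window Q)
  distinct-windows [] [] = []
  distinct-windows (a<Q ∷ sorted) (_ ∷ freshQ) =
    AllP.map⁺ (All.zipWith (λ (a<b , b-fresh) → fresh⇒new S m b-fresh a<b) (a<Q , freshQ))
      ∷ distinct-windows sorted freshQ
  distinct : AllPairs _≢_ (map window P)
  distinct = distinct-windows
    (AllPairsP.filter⁺ (T? ∘ fresh S m) (AllPairsP.applyUpTo⁺₁ id X (λ i<j _ → i<j)))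
    (AllP.all-filter (T? ∘ fresh S m) (upTo X))
  contained : All (_∈ deduplicate _≟s_ (substrings S m)) (map window P)
  contained = AllP.map⁺ (All.map (∈-deduplicate⁺ _≟s_ ∘ substr∈substrings S m)
    (AllP.filter⁺ (T? ∘ fresh S m) (AllP.all-upTo X)))

-- Position 0 is always fresh, so a nonempty string has at least one letter.
1≤d₁ : ∀ S → 1 ≤ length S → 1 ≤ d S 1
1≤d₁ S 1≤n = NP.≤-trans (position-0 (length S) 1≤n) (fresh≤d S 1)
  where
  position-0 : ∀ n → 1 ≤ n → 1 ≤ count (fresh S 1) n
  position-0 (suc n) _ = NP.m≤m+n 1 _

≤-max : ∀ (g : ℕ → ℚ) n {p} → p < n → g p ℚ.≤ foldr _⊔_ 0ℚ (applyUpTo g n)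
≤-max g (suc n) {zero} _ = ℚP.p≤p⊔q (g 0) _
≤-max g (suc n) {suc p} (s≤s p<n) = ℚP.p≤q⇒p≤r⊔q (g 0) (≤-max (g ∘ suc) n p<n)

d/m≤δ : ∀ S m → m < length S → (+ d S (suc m)) ℚ./ suc m ℚ.≤ δ S
d/m≤δ S m m<n = subst (λ xs → g m ℚ.≤ foldr _⊔_ 0ℚ xs) (sym (LP.map-upTo g (length S)))
  (≤-max g (length S) m<n)
  where
  g : ℕ → ℚ
  g k = (+ d S (suc k)) ℚ./ suc k

ℕ-to-ℚ : ∀ M c D m → M * suc m ≤ c * D →
         (+ M) ℚ./ 1 ℚ.≤ ((+ c) ℚ./ 1) ℚ.* ((+ D) ℚ./ suc m)
ℕ-to-ℚ M c D m M*m≤c*D = ℚP.toℚᵘ-cancel-≤ (begin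
  ℚ.toℚᵘ ((+ M) ℚ./ 1)                               ≃⟨ ℚP.toℚᵘ-fromℚᵘ (mkℚᵘ (+ M) 0) ⟩
  mkℚᵘ (+ M) 0                                        ≤⟨ ℚᵘ.*≤* cross-multiplied ⟩
  mkℚᵘ (+ c) 0 ℚᵘ.* mkℚᵘ (+ D) m                      ≃⟨ ℚᵘP.*-cong (ℚP.toℚᵘ-fromℚᵘ (mkℚᵘ (+ c) 0))
                                                                   (ℚP.toℚᵘ-fromℚᵘ (mkℚᵘ (+ D) m)) ⟨
  ℚ.toℚᵘ ((+ c) ℚ./ 1) ℚᵘ.* ℚ.toℚᵘ ((+ D) ℚ./ suc m)  ≃⟨ ℚP.toℚᵘ-homo-* ((+ c) ℚ./ 1) ((+ D) ℚ./ suc m) ⟨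
  ℚ.toℚᵘ (((+ c) ℚ./ 1) ℚ.* ((+ D) ℚ./ suc m))        ∎)
  where
  open ℚᵘP.≤-Reasoning
  cross-multiplied : + M ℤ.* + (1 * suc m) ℤ.≤ (+ c ℤ.* + D) ℤ.* + 1
  cross-multiplied = Z.begin
    + M ℤ.* + (1 * suc m)  Z.≡⟨ ℤP.pos-* M (1 * suc m) ⟨
    + (M * (1 * suc m))    Z.≡⟨ cong (λ k → + (M * k)) (NP.*-identityˡ (suc m)) ⟩
    + (M * suc m)          Z.≤⟨ ℤ.+≤+ M*m≤c*D ⟩
    + (c * D)              Z.≡⟨ ℤP.pos-* c D ⟩
    + c ℤ.* + D            Z.≡⟨ ℤP.*-identityʳ (+ c ℤ.* + D) ⟨
    (+ c ℤ.* + D) ℤ.* + 1  Z.∎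
    where module Z = ℤP.≤-Reasoning

bound-by-δ : ∀ S M c m → 1 ≤ m → m ≤ length S → M * m ≤ c * d S m →
             (+ M) ℚ./ 1 ℚ.≤ ((+ c) ℚ./ 1) ℚ.* δ S
bound-by-δ S M c (suc m) _ m<n M*m≤c*d =
  ℚP.≤-trans (ℕ-to-ℚ M c (d S (suc m)) m M*m≤c*d)
             (ℚP.*-monoˡ-≤-nonNeg ((+ c) ℚ./ 1) {{ℚP.normalize-nonNeg c 1}} (d/m≤δ S m m<n))

module Level (S : Str) (τ s t : ℕ) .{{_ : NonZero τ}} where
  open BlockTree S τ s t

  pairStart : ℕ → ℕ → Bool
  pairStart e i = present e i ∧ (present e (suc i) ∧ leftmostPair e i)

  present-bound : ∀ e i → T (present e i) → i < nblocks e
  present-bound zero i p = subst (i <_) (sym (NP.*-identityʳ s)) (NP.<ᵇ⇒< i s p)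
  present-bound (suc e) i p = begin-strict
    i                      ≡⟨ m≡m%n+[m/n]*n i τ ⟩
    i % τ + (i / τ) * τ    <⟨ NP.+-monoˡ-< ((i / τ) * τ) (m%n<n i τ) ⟩
    suc (i / τ) * τ        ≤⟨ NP.*-monoˡ-≤ τ (present-bound e (i / τ) (∧-left p)) ⟩
    (s * τ ^ e) * τ        ≡⟨ NP.*-assoc s (τ ^ e) τ ⟩
    s * (τ ^ e * τ)        ≡⟨ cong (s *_) (NP.*-comm (τ ^ e) τ) ⟩
    s * τ ^ suc e          ∎
    where open NP.≤-Reasoning

  -- A pair start is followed by a present block, so it is not among the last two.
  pairStart-bound : ∀ e i → T (pairStart e i) → i + 2 ≤ nblocks e
  pairStart-bound e i q = subst (_≤ nblocks e) (NP.+-comm 2 i)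
    (present-bound e (suc i) (∧-left {present e (suc i)} (∧-right {present e i} q)))

  marked-in-pair : ∀ e i → ind (marked e i) ≤ ind (shiftʳ (pairStart e) i) + ind (pairStart e i)
  marked-in-pair e zero = NP.≤-refl
  marked-in-pair e (suc i) = split (present e (suc i)) (present e i) (leftmostPair e i) _
    where
    split : ∀ p a c b → ind (p ∧ ((a ∧ c) ∨ b)) ≤ ind (a ∧ (p ∧ c)) + ind (p ∧ b)
    split false a c b = z≤n
    split true true true b = s≤s z≤n
    split true true false b = NP.≤-refl
    split true false c b = NP.≤-refl

  marked≤pairs : ∀ e → markedCount e ≤ 2 * count (pairStart e) (nblocks e)
  marked≤pairs e = begin
    markedCount e
      ≡⟨ cong sum (LP.map-upTo (λ i → ind (marked e i)) (nblocks e)) ⟩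
    sum (applyUpTo (λ i → ind (marked e i)) (nblocks e))
      ≡⟨ sum-applyUpTo (marked e) (nblocks e) ⟩
    count (marked e) (nblocks e)
      ≤⟨ count-≤-+ (marked e) _ _ (nblocks e) (marked-in-pair e) ⟩
    count (shiftʳ (pairStart e)) (nblocks e) + count (pairStart e) (nblocks e)
      ≤⟨ NP.+-monoˡ-≤ _ (count-shiftʳ (pairStart e) (nblocks e)) ⟩
    count (pairStart e) (nblocks e) + count (pairStart e) (nblocks e)
      ≡⟨ cong (λ x → count (pairStart e) (nblocks e) + x) (NP.+-identityʳ _) ⟨
    2 * count (pairStart e) (nblocks e) ∎
    where
    open NP.≤-Reasoning
    sum-applyUpTo : ∀ f n → sum (applyUpTo (λ i → ind (f i)) n) ≡ count f n
    sum-applyUpTo f zero = refl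
    sum-applyUpTo f (suc n) = cong (λ x → ind (f 0) + x) (sum-applyUpTo (f ∘ suc) n)

  -- Interior pair starts (blocks 1 .. N-3) number at most d_{3ℓ}(S)/ℓ: every length-3ℓ
  -- window starting in the block before an interior pair start is fresh.
  interior-pairs : ∀ e → length S ≡ nblocks e * blen e →
                   count (pairStart e ∘ suc) (nblocks e ∸ 3) * blen e ≤ d S (3 * blen e)
  interior-pairs e n≡Nℓ = begin
    count (pairStart e ∘ suc) K * ℓ       ≤⟨ count-blocks (fresh S (3 * ℓ)) _ ℓ K window-fresh ⟩
    count (fresh S (3 * ℓ)) (K * ℓ)       ≤⟨ count-mono (fresh S (3 * ℓ)) K*ℓ≤range ⟩
    count (fresh S (3 * ℓ)) (suc n ∸ 3 * ℓ) ≤⟨ fresh≤d S (3 * ℓ) ⟩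
    d S (3 * ℓ)                           ∎
    where
    open NP.≤-Reasoning
    ℓ = blen e
    K = nblocks e ∸ 3
    n = length S
    K*ℓ≤range : K * ℓ ≤ suc n ∸ 3 * ℓ
    K*ℓ≤range = subst (_≤ suc n ∸ 3 * ℓ)
      (trans (cong (_∸ 3 * ℓ) n≡Nℓ) (sym (NP.*-distribʳ-∸ ℓ (nblocks e) 3)))
      (NP.∸-monoˡ-≤ (3 * ℓ) (NP.n≤1+n n))
    window-fresh : ∀ {j r} → j < K → r < ℓ → T (pairStart e (suc j)) →
                   T (fresh S (3 * ℓ) (j * ℓ + r))
    window-fresh {j} {r} _ r<ℓ q = fresh-window S (3 * ℓ) (2 * ℓ) (j * ℓ + r) (suc j * ℓ)
      (subst (j * ℓ + r ≤_) (NP.+-comm (j * ℓ) ℓ) (NP.+-monoʳ-≤ (j * ℓ) (NP.<⇒≤ r<ℓ)))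
      (subst (suc j * ℓ + 2 * ℓ ≤_) pair-end (NP.m≤n+m (suc j * ℓ + 2 * ℓ) r))
      (∧-right {present e (suc (suc j))} (∧-right {present e (suc j)} q))
      where
      open +-*-Solver
      -- the pair S[(j+1)ℓ .. (j+3)ℓ) ends inside the window S[jℓ+r .. (j+3)ℓ+r)
      pair-end : r + (suc j * ℓ + 2 * ℓ) ≡ j * ℓ + r + 3 * ℓ
      pair-end = solve 3 (λ j ℓ r → r :+ ((con 1 :+ j) :* ℓ :+ con 2 :* ℓ)
                                    := j :* ℓ :+ r :+ con 3 :* ℓ) refl j ℓ r

  level-size : ∀ e → e ≤ t → s * τ ^ t ≡ nblocks e * blen e
  level-size e e≤t = begin
    s * τ ^ t                  ≡⟨ cong (λ x → s * τ ^ x) (NP.m+[n∸m]≡n e≤t) ⟨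
    s * τ ^ (e + (t ∸ e))      ≡⟨ cong (s *_) (NP.^-distribˡ-+-* τ e (t ∸ e)) ⟩
    s * (τ ^ e * τ ^ (t ∸ e))  ≡⟨ NP.*-assoc s (τ ^ e) (τ ^ (t ∸ e)) ⟨
    s * τ ^ e * τ ^ (t ∸ e)    ∎
    where open ≡-Reasoning

  marked-bound : ∀ e → 1 ≤ length S → length S ≡ nblocks e * blen e →
                 ∃[ m ] (1 ≤ m × m ≤ length S × markedCount e * m ≤ 18 * d S m)
  marked-bound e 1≤n n≡Nℓ = witness C' refl
    where
    ℓ = blen e
    M = markedCount e
    C' = count (pairStart e ∘ suc) (nblocks e ∸ 3)
    M≤2[2+C'] : M ≤ 2 * (2 + C')
    M≤2[2+C'] = NP.≤-trans (marked≤pairs e)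
      (NP.*-monoʳ-≤ 2 (count-trim (pairStart e) (nblocks e) (pairStart-bound e)))
    witness : ∀ c → c ≡ C' → ∃[ m ] (1 ≤ m × m ≤ length S × M * m ≤ 18 * d S m)
    -- no interior pair: at most four marked blocks, and d₁(S) ≥ 1
    witness zero 0≡C' = 1 , NP.≤-refl , 1≤n , (begin
      M * 1        ≡⟨ NP.*-identityʳ M ⟩
      M            ≤⟨ M≤2[2+C'] ⟩
      2 * (2 + C') ≡⟨ cong (λ x → 2 * (2 + x)) 0≡C' ⟨
      4            ≤⟨ NP.m≤m+n 4 14 ⟩
      18 * 1       ≤⟨ NP.*-monoʳ-≤ 18 (1≤d₁ S 1≤n) ⟩
      18 * d S 1   ∎)
      where open NP.≤-Reasoning
    witness (suc c) c≡C' = 3 * ℓ , NP.*-mono-≤ {1} {3} (s≤s z≤n) (NP.m^n>0 τ (t ∸ e)) , 3ℓ≤n , (begin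
      M * (3 * ℓ)                  ≤⟨ NP.*-monoˡ-≤ (3 * ℓ) (NP.≤-trans M≤2[2+C'] (NP.≤-reflexive
                                        (cong (λ x → 2 * (2 + x)) (sym c≡C')))) ⟩
      2 * (2 + suc c) * (3 * ℓ)    ≤⟨ NP.*-monoˡ-≤ (3 * ℓ) (NP.≤-trans (NP.m≤m+n (2 * (2 + suc c)) (4 * c))
                                        (NP.≤-reflexive (six c))) ⟩
      6 * suc c * (3 * ℓ)          ≡⟨ eighteen (suc c) ℓ ⟩
      18 * (suc c * ℓ)             ≤⟨ NP.*-monoʳ-≤ 18 (subst (λ x → x * ℓ ≤ d S (3 * ℓ)) (sym c≡C')
                                        (interior-pairs e n≡Nℓ)) ⟩
      18 * d S (3 * ℓ)             ∎)
      where
      open NP.≤-Reasoning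
      open +-*-Solver
      six : ∀ c → 2 * (2 + suc c) + 4 * c ≡ 6 * suc c
      six = solve 1 (λ c → con 2 :* (con 2 :+ (con 1 :+ c)) :+ con 4 :* c := con 6 :* (con 1 :+ c)) refl
      eighteen : ∀ c ℓ → 6 * c * (3 * ℓ) ≡ 18 * (c * ℓ)
      eighteen = solve 2 (λ c ℓ → con 6 :* c :* (con 3 :* ℓ) := con 18 :* (c :* ℓ)) refl
      -- an interior pair exists, so there are at least three blocks
      0<K : 0 < nblocks e ∸ 3
      0<K = NP.<-≤-trans (s≤s z≤n) (subst (_≤ nblocks e ∸ 3) (sym c≡C') (count≤ (pairStart e ∘ suc) _))
      3ℓ≤n : 3 * ℓ ≤ length S
      3ℓ≤n = subst (3 * ℓ ≤_) (sym n≡Nℓ)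
        (NP.*-monoˡ-≤ ℓ (NP.<⇒≤ (NP.m∸n≢0⇒n<m {nblocks e} {3} (NP.n>0⇒n≢0 0<K))))

marked≤18δ : (S : Str) (τ s t : ℕ) .{{_ : NonZero τ}} → 2 ≤ τ → 1 ≤ s →
             length S ≡ s * τ ^ t → (k : ℕ) → k ≤ t →
             (+ BlockTree.markedCount S τ s t (t ∸ k)) ℚ./ 1 ℚ.≤ ((+ 18) ℚ./ 1) ℚ.* δ S
marked≤18δ S τ s t _ 1≤s n≡sτ^t k _ =
  let e = t ∸ k
      (m , 1≤m , m≤n , M*m≤18d) =
        Level.marked-bound S τ s t e 1≤n (trans n≡sτ^t (Level.level-size S τ s t e (NP.m∸n≤m t k)))
  in bound-by-δ S (BlockTree.markedCount S τ s t e) 18 m 1≤m m≤n M*m≤18d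
  where
  1≤n : 1 ≤ length S
  1≤n = subst (1 ≤_) (sym n≡sτ^t) (NP.*-mono-≤ 1≤s (NP.m^n>0 τ t))

lemma14 : ∃[ c ] ((S : Str) (τ s t : ℕ) .{{_ : NonZero τ}} → 2 ≤ τ → 1 ≤ s →
            length S ≡ s * τ ^ t → (k : ℕ) → k ≤ t →
            (+ BlockTree.markedCount S τ s t (t ∸ k)) ℚ./ 1 ℚ.≤ ((+ c) ℚ./ 1) ℚ.* δ S)
lemma14 = 18 , marked≤18δ
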